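{- Let $(W,S)$ be a finite Coxeter system, let $I,J\subsetneq S$ with $I\cup J=S$, and let $H$ be the $(I,J;W,S)$-graph, with parts $A=W/W_I$ and $B=W/W_J$. Then $H$ strongly percolates if and only if, for each $w\in W$ with $wW_I\ne W_I$, there is a strong vertex-percolating sequence in $A$ starting with $\{W_I,wW_I\}$, and, for each $w\in W$ with $wW_J\ne W_J$, there is a strong vertex-percolating sequence in $B$ starting with $\{W_J,wW_J\}$.
   Context: A finite Coxeter system $(W,S)$: $W$ is a finite group with generating set $S=\{s_1,\dots,s_m\}$ and presentation $\langle s_1,\dots,s_m \mid (s_is_j)^{m_{ij}}=1\rangle$, $m_{ii}=1$, $m_{ij}=m_{ji}\ge2$ for $i\ne j$; $W_I$ is the subgroup generated by $I\subseteq S$. The $(I,J;W,S)$-graph is the bipartite graph with parts $W/W_I$ and $W/W_J$ in which $wW_I$ and $wW_J$ are adjacent for every $w\in W$. A cut involution of a graph $H$ is an automorphism $\phi$ with $\phi^2=\mathrm{id}$ together with a partition $L_\phi\cup F_\phi\cup R_\phi$ of $V(H)$ such that $\phi$ fixes every vertex of $F_\phi$, $\phi(L_\phi)=R_\phi$, and no edge joins $L_\phi$ to $R_\phi$. Its folding maps are $\phi^+(v)=\phi(v)$ if $v\in R_\phi$, $\phi^+(v)=v$ otherwise, and $\phi^-(v)=\phi(v)$ if $v\in L_\phi$, $\phi^-(v)=v$ otherwise; for $K\subseteq V(H)$, $K^\pm(\phi)=\{v:\phi^\pm(v)\in K\}$. If $H$ is a connected bipartite graph with bipartition $A\cup B$,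 a strong vertex-percolating sequence in $A$ is a finite sequence $J_0,\dots,J_N$ of subsets of $A$ such that: for each $i<N$ there is a cut involution $\phi_i$ with $J_{i+1}=J_i^+(\phi_i)$ or $J_{i+1}=J_i^-(\phi_i)$; $J_0$ consists of two vertices of $A$; $J_N=A$; and each $J_i$ ($i<N$) intersects both $F_{\phi_i}\cup L_{\phi_i}$ and $F_{\phi_i}\cup R_{\phi_i}$. (Similarly for $B$.) $H$ strongly percolates if every two-element subset $J_0$ of $A$ (resp. of $B$) is the first term of a strong vertex-percolating sequence in $A$ (resp. in $B$). -}

module Defs where

open import Level using (Level; _⊔_) renaming (suc to lsuc)
open import Algebra.Bundles using (Group)
open import Algebra.Morphism.Structures using (IsGroupHomomorphism)
open import Data.Nat using (ℕ; zero; suc; _≤_)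
open import Data.Fin using (Fin; zero; suc; inject₁; fromℕ)
open import Data.Fin.Subset using (Subset; _∈_)
open import Data.Sum using (_⊎_; inj₁; inj₂)
open import Data.Product using (Σ; _×_; ∃; ∃-syntax)
open import Relation.Nullary using (¬_)
open import Relation.Binary.PropositionalEquality using (_≡_; _≢_)
open import Function.Bundles using (_⇔_)
open import Data.Unit using (⊤)

module _ {c ℓ} (G : Group c ℓ) where
  open Group G

  pow : Carrier → ℕ → Carrier
  pow g zero    = ε
  pow g (suc n) = g ∙ pow g n

  data Generated {k p} (t : Fin k → Carrier) (P : Fin k → Set p)
       : Carrier → Set (c ⊔ ℓ ⊔ p) where
    g-ε   : Generated t P ε
    g-gen : ∀ i → P i → Generated t P (t i)
    g-∙   : ∀ {x y} → Generated t P x → Generated t P y → Generated t P (x ∙ y)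
    g-⁻¹  : ∀ {x} → Generated t P x → Generated t P (x ⁻¹)
    g-≈   : ∀ {x y} → x ≈ y → Generated t P x → Generated t P y

-- Finite Coxeter systems (W,S), S = {s_1,…,s_rank}, with Coxeter matrix m.
-- "W has the presentation ⟨S | (s_i s_j)^{m_ij} = 1⟩" is expressed as:
-- the relations hold, S generates W, and every assignment of the generators
-- to a group satisfying the relations extends to a group homomorphism.

record FiniteCoxeterSystem (c ℓ : Level) : Set (lsuc (c ⊔ ℓ)) where
  field
    W     : Group c ℓ
  open Group W
  field
    rank  : ℕ
    s     : Fin rank → Carrier
    m     : Fin rank → Fin rank → ℕ
    m-diag : ∀ i → m i i ≡ 1
    m-sym  : ∀ i j → m i j ≡ m j i
    m-off  : ∀ i j → i ≢ j → 2 ≤ m i j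
    relations : ∀ i j → pow W (s i ∙ s j) (m i j) ≈ ε
    generates : ∀ w → Generated W s (λ _ → ⊤) w
    universal : (G : Group c ℓ) (t : Fin rank → Group.Carrier G) →
                (∀ i j → Group._≈_ G (pow G (Group._∙_ G (t i) (t j)) (m i j)) (Group.ε G)) →
                Σ (Carrier → Group.Carrier G) λ f →
                  IsGroupHomomorphism (Group.rawGroup W) (Group.rawGroup G) f ×
                  (∀ i → Group._≈_ G (f (s i)) (t i))
    -- finiteness: an explicit enumeration of W (bijection with Fin size, up to ≈)
    size      : ℕ
    enum      : Fin size → Carrier
    enum-surj : ∀ w → Σ (Fin size) λ n → enum n ≈ w
    enum-inj  : ∀ n n' → enum n ≈ enum n' → n ≡ n'

-- Graphs: a vertex type with an equality relation (vertices are taken up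
-- to _≈_, e.g. cosets given by representatives) and an adjacency relation.

record Graph (v r e : Level) : Set (lsuc (v ⊔ r ⊔ e)) where
  field
    V   : Set v
    _≈_ : V → V → Set r
    E   : V → V → Set e

data Side : Set where
  L F R : Side

record CutInvolution {v r e} (H : Graph v r e) : Set (v ⊔ r ⊔ e) where
  open Graph H
  field
    φ        : V → V
    φ-cong   : ∀ {x y} → x ≈ y → φ x ≈ φ y
    φ-adj    : ∀ x y → E x y ⇔ E (φ x) (φ y)
    φ-invol  : ∀ x → φ (φ x) ≈ x
    side     : V → Side
    side-cong : ∀ {x y} → x ≈ y → side x ≡ side y
    fixes-F  : ∀ x → side x ≡ F → φ x ≈ x
    φL⊆R     : ∀ x → side x ≡ L → side (φ x) ≡ R
    R⊆φL     : ∀ y → side y ≡ R → Σ V λ x → side x ≡ L × φ x ≈ y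
    no-LR    : ∀ x y → side x ≡ L → side y ≡ R → ¬ E x y

module _ {v r e} {H : Graph v r e} (φ : CutInvolution H) where
  open Graph H
  open CutInvolution φ renaming (φ to f)

  -- φ⁺(x) = φ(x) if x ∈ R, x otherwise;  φ⁻(x) = φ(x) if x ∈ L, x otherwise
  fold⁺ : V → V
  fold⁺ x with side x
  ... | L = x
  ... | F = x
  ... | R = f x

  fold⁻ : V → V
  fold⁻ x with side x
  ... | L = f x
  ... | F = x
  ... | R = x

  _⁺ : ∀ {q} → (V → Set q) → (V → Set q)
  (K ⁺) x = K (fold⁺ x)

  _⁻ : ∀ {q} → (V → Set q) → (V → Set q)
  (K ⁻) x = K (fold⁻ x)

-- Subsets of V are predicates
-- (respected up to ≈ in all uses), equality of subsets is pointwise ⇔.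

_≐_ : ∀ {a p q} {A : Set a} → (A → Set p) → (A → Set q) → Set (a ⊔ p ⊔ q)
K ≐ K' = ∀ x → K x ⇔ K' x

record StrongPercSeq {v r e p} (H : Graph v r e) (P : Graph.V H → Set p)
                     (a b : Graph.V H) : Set (lsuc (v ⊔ r ⊔ e ⊔ p)) where
  open Graph H
  field
    N      : ℕ
    J      : Fin (suc N) → V → Set (v ⊔ r ⊔ e ⊔ p)
    φ      : Fin N → CutInvolution H
    J⊆P    : ∀ i x → J i x → P x
    a∈P    : P a
    b∈P    : P b
    a≉b    : ¬ (a ≈ b)
    J₀     : J zero ≐ (λ x → (x ≈ a) ⊎ (x ≈ b))
    step   : ∀ i → (J (suc i) ≐ (φ i ⁺) (J (inject₁ i)))
                 ⊎ (J (suc i) ≐ (φ i ⁻) (J (inject₁ i)))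
    Jₙ     : J (fromℕ N) ≐ P
    meets-FL : ∀ i → ∃[ x ] (J (inject₁ i) x × CutInvolution.side (φ i) x ≢ R)
    meets-FR : ∀ i → ∃[ x ] (J (inject₁ i) x × CutInvolution.side (φ i) x ≢ L)

-- The (I,J;W,S)-graph: vertices inj₁ w ↦ wW_I (part A), inj₂ w ↦ wW_J
-- (part B); wW_I and wW_J adjacent for every w.

module CoxeterGraph {c ℓ} (CS : FiniteCoxeterSystem c ℓ) where
  open FiniteCoxeterSystem CS
  open Group W using (Carrier; _∙_; _⁻¹)

  InParabolic : Subset rank → Carrier → Set (c ⊔ ℓ)
  InParabolic I = Generated W s (λ i → i ∈ I)

  SameCoset : Subset rank → Carrier → Carrier → Set (c ⊔ ℓ)
  SameCoset I x y = InParabolic I (x ⁻¹ ∙ y)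

  module _ (I J : Subset rank) where
    Vertex : Set c
    Vertex = Carrier ⊎ Carrier

    data _≈V_ : Vertex → Vertex → Set (c ⊔ ℓ) where
      AA : ∀ {x y} → SameCoset I x y → inj₁ x ≈V inj₁ y
      BB : ∀ {x y} → SameCoset J x y → inj₂ x ≈V inj₂ y

    data Adj : Vertex → Vertex → Set (c ⊔ ℓ) where
      AB : ∀ {x y} w → SameCoset I x w → SameCoset J y w → Adj (inj₁ x) (inj₂ y)
      BA : ∀ {x y} w → SameCoset J x w → SameCoset I y w → Adj (inj₂ x) (inj₁ y)

    graph : Graph c (c ⊔ ℓ) (c ⊔ ℓ)
    graph = record { V = Vertex ; _≈_ = _≈V_ ; E = Adj }

    data PartA : Vertex → Set c where
      inA : ∀ x → PartA (inj₁ x)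

    data PartB : Vertex → Set c where
      inB : ∀ x → PartB (inj₂ x)

    StronglyPercolates : Set (lsuc (c ⊔ ℓ))
    StronglyPercolates =
      (∀ a b → PartA a → PartA b → ¬ (a ≈V b) → StrongPercSeq graph PartA a b) ×
      (∀ a b → PartB a → PartB b → ¬ (a ≈V b) → StrongPercSeq graph PartB a b)

-- Left multiplication by g ∈ W is an automorphism of the (I,J;W,S)-graph, and W
-- acts transitively on each of the parts W/W_I and W/W_J.  Conjugating every cut
-- involution of a strong vertex-percolating sequence by an automorphism (and
-- translating its sets) gives another one, so the sequence starting at
-- {W_I, x⁻¹y W_I} is carried to one starting at {xW_I, yW_I}; likewise in B.
module Submission where

open import Defs
open import Level using (_⊔_)
open import Algebra.Bundles using (Group)
open import Data.Fin using (Fin; zero; suc; inject₁)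
open import Data.Fin.Induction using (<-weakInduction)
open import Data.Fin.Subset using (Subset; _∈_; _⊂_; _∪_; ⊤)
open import Data.Sum using (inj₁; inj₂; [_,_])
open import Data.Sum.Function.Propositional using (_⊎-⇔_)
open import Data.Product using (_×_; _,_; Σ-syntax; ∃-syntax)
open import Function using (_∘_)
open import Function.Bundles using (_⇔_; mk⇔; Equivalence)
open import Function.Properties.Equivalence using () renaming (trans to ⇔-trans)
open import Relation.Binary.Definitions using (_Respects_)
open import Relation.Binary.Structures using (IsEquivalence)
open import Relation.Binary.PropositionalEquality using (_≡_; _≢_; refl) renaming (trans to ≡-trans)
open import Relation.Nullary using (¬_)

open Equivalence using (to; from)

record Automorphism {v r e} (H : Graph v r e) : Set (v ⊔ r ⊔ e) where
  open Graph H
  field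
    apply         : V → V
    inverse       : V → V
    apply-cong    : ∀ {x y} → x ≈ y → apply x ≈ apply y
    inverse-cong  : ∀ {x y} → x ≈ y → inverse x ≈ inverse y
    apply-adj     : ∀ x y → E x y ⇔ E (apply x) (apply y)
    inverse-adj   : ∀ x y → E x y ⇔ E (inverse x) (inverse y)
    inverse-apply : ∀ x → inverse (apply x) ≈ x
    apply-inverse : ∀ x → apply (inverse x) ≈ x

Invariant : ∀ {v r e p} {H : Graph v r e} → (Graph.V H → Set p) → Automorphism H → Set (v ⊔ p)
Invariant P τ = ∀ x → P x ⇔ P (Automorphism.apply τ x)

TransitiveOn : ∀ {v r e p} (H : Graph v r e) → (Graph.V H → Set p) → Graph.V H →
               Set (v ⊔ r ⊔ e ⊔ p)
TransitiveOn H P o = ∀ a → P a →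
  Σ[ τ ∈ Automorphism H ] (Invariant P τ × Graph._≈_ H (Automorphism.apply τ o) a)

module _ {v r e} {H : Graph v r e} (ψ : CutInvolution H) where
  open Graph H
  open CutInvolution ψ

  fold⁺-cong : ∀ {x y} → x ≈ y → fold⁺ ψ x ≈ fold⁺ ψ y
  fold⁺-cong {x} {y} x≈y with side x | side y | side-cong x≈y
  ... | L | L | refl = x≈y
  ... | F | F | refl = x≈y
  ... | R | R | refl = φ-cong x≈y

  fold⁻-cong : ∀ {x y} → x ≈ y → fold⁻ ψ x ≈ fold⁻ ψ y
  fold⁻-cong {x} {y} x≈y with side x | side y | side-cong x≈y
  ... | L | L | refl = φ-cong x≈y
  ... | F | F | refl = x≈y
  ... | R | R | refl = x≈y

module _ {v r e} {H : Graph v r e} (≈-isEquivalence : IsEquivalence (Graph._≈_ H)) where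
  open Graph H
  open IsEquivalence ≈-isEquivalence renaming (refl to ≈-refl; sym to ≈-sym; trans to ≈-trans)

  respects⇒⇔ : ∀ {q} {K : V → Set q} → K Respects _≈_ → ∀ {x y} → x ≈ y → K x ⇔ K y
  respects⇒⇔ resp x≈y = mk⇔ (resp x≈y) (resp (≈-sym x≈y))

  module _ {p} {P : V → Set p} where

    J-respects : ∀ {a b} (S : StrongPercSeq H P a b) → ∀ i → StrongPercSeq.J S i Respects _≈_
    J-respects S = <-weakInduction (λ i → J i Respects _≈_) J₀-respects step-respects
      where
      open StrongPercSeq S

      J₀-respects : J zero Respects _≈_
      J₀-respects {x} {y} x≈y =
        from (J₀ y) ∘ [ inj₁ ∘ ≈-trans (≈-sym x≈y) , inj₂ ∘ ≈-trans (≈-sym x≈y) ] ∘ to (J₀ x)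

      pullback-respects : ∀ {K K′ : V → Set _} {f : V → V} → (∀ {x y} → x ≈ y → f x ≈ f y) →
                          K Respects _≈_ → K′ ≐ (K ∘ f) → K′ Respects _≈_
      pullback-respects f-cong resp K′≐K∘f {x} {y} x≈y =
        from (K′≐K∘f y) ∘ resp (f-cong x≈y) ∘ to (K′≐K∘f x)

      step-respects : ∀ i → J (inject₁ i) Respects _≈_ → J (suc i) Respects _≈_
      step-respects i resp {x} {y} =
        [ (λ st → pullback-respects (fold⁺-cong (φ i)) resp st)
        , (λ st → pullback-respects (fold⁻-cong (φ i)) resp st) ] (step i)

    strongPercSeq-resp : P Respects _≈_ → ∀ {a b a′ b′} → a ≈ a′ → b ≈ b′ →
                         StrongPercSeq H P a b → StrongPercSeq H P a′ b′
    strongPercSeq-resp P-resp a≈a′ b≈b′ S = record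
      { N = N ; J = J ; φ = φ ; J⊆P = J⊆P ; step = step ; Jₙ = Jₙ
      ; meets-FL = meets-FL ; meets-FR = meets-FR
      ; a∈P = P-resp a≈a′ a∈P
      ; b∈P = P-resp b≈b′ b∈P
      ; a≉b = λ a′≈b′ → a≉b (≈-trans a≈a′ (≈-trans a′≈b′ (≈-sym b≈b′)))
      ; J₀  = λ x → ⇔-trans (J₀ x) (≈-respʳ a≈a′ ⊎-⇔ ≈-respʳ b≈b′)
      }
      where
      open StrongPercSeq S

      ≈-respʳ : ∀ {x y z} → y ≈ z → x ≈ y ⇔ x ≈ z
      ≈-respʳ y≈z = mk⇔ (λ e → ≈-trans e y≈z) (λ e → ≈-trans e (≈-sym y≈z))

  module _ (τ : Automorphism H) where
    open Automorphism τ

    inverse-≈⇔≈-apply : ∀ {x y} → inverse x ≈ y ⇔ x ≈ apply y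
    inverse-≈⇔≈-apply {x} = mk⇔ (λ e → ≈-trans (≈-sym (apply-inverse x)) (apply-cong e))
                               (λ e → ≈-trans (inverse-cong e) (inverse-apply _))

    apply-injective : ∀ {x y} → apply x ≈ apply y → x ≈ y
    apply-injective {x} {y} e =
      ≈-trans (≈-sym (inverse-apply x)) (≈-trans (inverse-cong e) (inverse-apply y))

    conjugate : CutInvolution H → CutInvolution H
    conjugate ψ = record
      { φ         = apply ∘ φ ∘ inverse
      ; φ-cong    = apply-cong ∘ φ-cong ∘ inverse-cong
      ; φ-adj     = λ x y → ⇔-trans (inverse-adj x y) (⇔-trans (φ-adj _ _) (apply-adj _ _))
      ; φ-invol   = λ x → ≈-trans (apply-cong (≈-trans (φ-cong (inverse-apply _)) (φ-invol _)))
                                  (apply-inverse x)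
      ; side      = side ∘ inverse
      ; side-cong = side-cong ∘ inverse-cong
      ; fixes-F   = λ x x∈F → ≈-trans (apply-cong (fixes-F _ x∈F)) (apply-inverse x)
      ; φL⊆R      = λ x x∈L → ≡-trans (side-cong (inverse-apply _)) (φL⊆R _ x∈L)
      ; R⊆φL      = λ y y∈R → let (x , x∈L , φx≈y) = R⊆φL _ y∈R in
          apply x , ≡-trans (side-cong (inverse-apply x)) x∈L ,
          ≈-trans (apply-cong (≈-trans (φ-cong (inverse-apply x)) φx≈y)) (apply-inverse y)
      ; no-LR     = λ x y x∈L y∈R → no-LR _ _ x∈L y∈R ∘ to (inverse-adj x y)
      }
      where open CutInvolution ψ

    module _ (ψ : CutInvolution H) where
      open CutInvolution ψ

      inverse-fold⁺ : ∀ x → inverse (fold⁺ (conjugate ψ) x) ≈ fold⁺ ψ (inverse x)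
      inverse-fold⁺ x with side (inverse x)
      ... | L = ≈-refl
      ... | F = ≈-refl
      ... | R = inverse-apply _

      inverse-fold⁻ : ∀ x → inverse (fold⁻ (conjugate ψ) x) ≈ fold⁻ ψ (inverse x)
      inverse-fold⁻ x with side (inverse x)
      ... | L = inverse-apply _
      ... | F = ≈-refl
      ... | R = ≈-refl

    transport : ∀ {p} {P : V → Set p} → P Respects _≈_ → Invariant P τ →
                ∀ {a b} → StrongPercSeq H P a b → StrongPercSeq H P (apply a) (apply b)
    transport {P = P} P-resp P-inv {a} {b} S = record
      { N        = N
      ; J        = λ i → J i ∘ inverse
      ; φ        = conjugate ∘ φ
      ; J⊆P      = λ i x → to (P-inverse x) ∘ J⊆P i (inverse x)
      ; a∈P      = to (P-inv a) a∈P
      ; b∈P      = to (P-inv b) b∈P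
      ; a≉b      = a≉b ∘ apply-injective
      ; J₀       = λ x → ⇔-trans (J₀ (inverse x)) (inverse-≈⇔≈-apply ⊎-⇔ inverse-≈⇔≈-apply)
      ; step     = λ i → [ inj₁ ∘ step-along fold⁺ (inverse-fold⁺ (φ i))
                         , inj₂ ∘ step-along fold⁻ (inverse-fold⁻ (φ i)) ] (step i)
      ; Jₙ       = λ x → ⇔-trans (Jₙ (inverse x)) (P-inverse x)
      ; meets-FL = meets-along ∘ meets-FL
      ; meets-FR = meets-along ∘ meets-FR
      }
      where
      open StrongPercSeq S

      P-inverse : ∀ x → P (inverse x) ⇔ P x
      P-inverse x = ⇔-trans (P-inv (inverse x)) (respects⇒⇔ P-resp (apply-inverse x))

      J-⇔ : ∀ {i x y} → x ≈ y → J i x ⇔ J i y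
      J-⇔ {i} = respects⇒⇔ (J-respects S i)

      step-along : ∀ {i} (fold : CutInvolution H → V → V) →
                   (∀ x → inverse (fold (conjugate (φ i)) x) ≈ fold (φ i) (inverse x)) →
                   J (suc i) ≐ (J (inject₁ i) ∘ fold (φ i)) →
                   (J (suc i) ∘ inverse) ≐ (J (inject₁ i) ∘ inverse ∘ fold (conjugate (φ i)))
      step-along fold inverse-fold st x = ⇔-trans (st (inverse x)) (J-⇔ (≈-sym (inverse-fold x)))

      meets-along : ∀ {i t} → ∃[ x ] (J (inject₁ i) x × CutInvolution.side (φ i) x ≢ t) →
                    ∃[ x ] (J (inject₁ i) (inverse x) × CutInvolution.side (φ i) (inverse x) ≢ t)
      meets-along {i} (x , x∈J , x∉t) =
        apply x , J-⇔ (≈-sym (inverse-apply x)) .to x∈J ,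
        x∉t ∘ ≡-trans (CutInvolution.side-cong (φ i) (≈-sym (inverse-apply x)))

  strongPercSeq-by-transitivity :
    ∀ {p} {P : V → Set p} → P Respects _≈_ → (o : V) →
    TransitiveOn H P o →
    (∀ b → P b → ¬ o ≈ b → StrongPercSeq H P o b) →
    ∀ a b → P a → P b → ¬ a ≈ b → StrongPercSeq H P a b
  strongPercSeq-by-transitivity {P = P} P-resp o transitive seq a b a∈P b∈P a≉b
    with transitive a a∈P
  ... | τ , P-inv , τo≈a =
    strongPercSeq-resp P-resp τo≈a (apply-inverse b)
      (transport τ P-resp P-inv (seq (inverse b) inverse-b∈P o≉inverse-b))
    where
    open Automorphism τ

    inverse-b∈P : P (inverse b)
    inverse-b∈P = from (P-inv (inverse b)) (P-resp (≈-sym (apply-inverse b)) b∈P)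

    o≉inverse-b : ¬ o ≈ inverse b
    o≉inverse-b o≈b′ = a≉b (≈-trans (≈-sym τo≈a) (≈-trans (apply-cong o≈b′) (apply-inverse b)))

module LeftCosets {c ℓ} (G : Group c ℓ) where
  open Group G renaming (refl to ≈-refl; sym to ≈-sym; trans to ≈-trans)
  open import Algebra.Properties.Group G

  [x∙y]\\z≈y\\[x\\z] : ∀ x y z → (x ∙ y) \\ z ≈ y \\ (x \\ z)
  [x∙y]\\z≈y\\[x\\z] x y z = begin
    (x ∙ y) ⁻¹ ∙ z      ≈⟨ ∙-congʳ (⁻¹-anti-homo-∙ x y) ⟩
    (y ⁻¹ ∙ x ⁻¹) ∙ z   ≈⟨ assoc _ _ _ ⟩
    y ⁻¹ ∙ (x ⁻¹ ∙ z)   ∎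
    where open import Relation.Binary.Reasoning.Setoid setoid

  module _ {k p} {t : Fin k → Carrier} {P : Fin k → Set p} where

    ≈⇒sameLeftCoset : ∀ {x y} → x ≈ y → Generated G t P (x \\ y)
    ≈⇒sameLeftCoset {x} x≈y = g-≈ (≈-sym (≈-trans (∙-congˡ (≈-sym x≈y)) (inverseˡ x))) g-ε

    sameLeftCoset-isEquivalence : IsEquivalence (λ x y → Generated G t P (x \\ y))
    sameLeftCoset-isEquivalence = record
      { refl  = ≈⇒sameLeftCoset ≈-refl
      ; sym   = λ {x} {y} x~y → g-≈ (⁻¹-anti-homo-\\ x y) (g-⁻¹ x~y)
      ; trans = λ {x} {y} {z} x~y y~z →
          g-≈ (≈-trans (assoc _ _ _) (∙-congˡ (\\-leftDividesˡ y z))) (g-∙ x~y y~z)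
      }

    sameLeftCoset-∙ˡ : ∀ g {x y} → Generated G t P (x \\ y) → Generated G t P ((g ∙ x) \\ (g ∙ y))
    sameLeftCoset-∙ˡ g {x} {y} =
      g-≈ (≈-sym (≈-trans ([x∙y]\\z≈y\\[x\\z] g x (g ∙ y)) (∙-congˡ (\\-leftDividesʳ g y))))

    sameLeftCoset-\\ˡ : ∀ g {x y} → Generated G t P ((g ∙ x) \\ y) → Generated G t P (x \\ (g \\ y))
    sameLeftCoset-\\ˡ g {x} {y} = g-≈ ([x∙y]\\z≈y\\[x\\z] g x y)

module Translations {c ℓ} (CS : FiniteCoxeterSystem c ℓ)
                    (I J : Subset (FiniteCoxeterSystem.rank CS)) where
  open FiniteCoxeterSystem CS
  open Group W using (Carrier; ε; _∙_; _⁻¹; identityʳ)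
  open import Algebra.Properties.Group W using (\\-leftDividesˡ; \\-leftDividesʳ)
  open CoxeterGraph CS
  open LeftCosets W
  open Graph (graph I J) using (_≈_)

  private
    module CosetI = IsEquivalence (sameLeftCoset-isEquivalence {t = s} {P = _∈ I})
    module CosetJ = IsEquivalence (sameLeftCoset-isEquivalence {t = s} {P = _∈ J})

  ≈V-isEquivalence : IsEquivalence _≈_
  ≈V-isEquivalence = record
    { refl  = λ { {inj₁ _} → AA CosetI.refl ; {inj₂ _} → BB CosetJ.refl }
    ; sym   = λ { (AA p) → AA (CosetI.sym p) ; (BB p) → BB (CosetJ.sym p) }
    ; trans = λ { (AA p) (AA q) → AA (CosetI.trans p q) ; (BB p) (BB q) → BB (CosetJ.trans p q) }
    }

  translate : Carrier → Vertex I J → Vertex I J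
  translate g (inj₁ x) = inj₁ (g ∙ x)
  translate g (inj₂ x) = inj₂ (g ∙ x)

  translate-cong : ∀ g {x y} → x ≈ y → translate g x ≈ translate g y
  translate-cong g (AA p) = AA (sameLeftCoset-∙ˡ g p)
  translate-cong g (BB p) = BB (sameLeftCoset-∙ˡ g p)

  translate-adj : ∀ g x y → Adj I J x y ⇔ Adj I J (translate g x) (translate g y)
  translate-adj g x y = mk⇔ preserves (reflects x y)
    where
    preserves : ∀ {x y} → Adj I J x y → Adj I J (translate g x) (translate g y)
    preserves (AB w p q) = AB (g ∙ w) (sameLeftCoset-∙ˡ g p) (sameLeftCoset-∙ˡ g q)
    preserves (BA w p q) = BA (g ∙ w) (sameLeftCoset-∙ˡ g p) (sameLeftCoset-∙ˡ g q)

    reflects : ∀ x y → Adj I J (translate g x) (translate g y) → Adj I J x y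
    reflects (inj₁ _) (inj₂ _) (AB w p q) =
      AB (g ⁻¹ ∙ w) (sameLeftCoset-\\ˡ g p) (sameLeftCoset-\\ˡ g q)
    reflects (inj₂ _) (inj₁ _) (BA w p q) =
      BA (g ⁻¹ ∙ w) (sameLeftCoset-\\ˡ g p) (sameLeftCoset-\\ˡ g q)

  translate-inverseˡ : ∀ g x → translate (g ⁻¹) (translate g x) ≈ x
  translate-inverseˡ g (inj₁ x) = AA (≈⇒sameLeftCoset (\\-leftDividesʳ g x))
  translate-inverseˡ g (inj₂ x) = BB (≈⇒sameLeftCoset (\\-leftDividesʳ g x))

  translate-inverseʳ : ∀ g x → translate g (translate (g ⁻¹) x) ≈ x
  translate-inverseʳ g (inj₁ x) = AA (≈⇒sameLeftCoset (\\-leftDividesˡ g x))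
  translate-inverseʳ g (inj₂ x) = BB (≈⇒sameLeftCoset (\\-leftDividesˡ g x))

  translation : Carrier → Automorphism (graph I J)
  translation g = record
    { apply         = translate g
    ; inverse       = translate (g ⁻¹)
    ; apply-cong    = translate-cong g
    ; inverse-cong  = translate-cong (g ⁻¹)
    ; apply-adj     = translate-adj g
    ; inverse-adj   = translate-adj (g ⁻¹)
    ; inverse-apply = translate-inverseˡ g
    ; apply-inverse = translate-inverseʳ g
    }

  PartA-respects : PartA I J Respects _≈_
  PartA-respects (AA _) (inA _) = inA _

  PartB-respects : PartB I J Respects _≈_
  PartB-respects (BB _) (inB _) = inB _

  PartA-transitive : TransitiveOn (graph I J) (PartA I J) (inj₁ ε)
  PartA-transitive _ (inA x) = translation x , invariant , AA (≈⇒sameLeftCoset (identityʳ x))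
    where
    invariant : Invariant (PartA I J) (translation x)
    invariant (inj₁ _) = mk⇔ (λ _ → inA _) (λ _ → inA _)
    invariant (inj₂ _) = mk⇔ (λ ()) (λ ())

  PartB-transitive : TransitiveOn (graph I J) (PartB I J) (inj₂ ε)
  PartB-transitive _ (inB x) = translation x , invariant , BB (≈⇒sameLeftCoset (identityʳ x))
    where
    invariant : Invariant (PartB I J) (translation x)
    invariant (inj₁ _) = mk⇔ (λ ()) (λ ())
    invariant (inj₂ _) = mk⇔ (λ _ → inB _) (λ _ → inB _)

lemma3p9 : ∀ {c ℓ} (CS : FiniteCoxeterSystem c ℓ) →
    let open FiniteCoxeterSystem CS in
    let open Group W in
    let open CoxeterGraph CS in
    (I J : Subset rank) → I ⊂ ⊤ → J ⊂ ⊤ → I ∪ J ≡ ⊤ →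
    StronglyPercolates I J ⇔
      ((∀ (w : Carrier) → ¬ SameCoset I ε w →
          StrongPercSeq (graph I J) (PartA I J) (inj₁ ε) (inj₁ w)) ×
       (∀ (w : Carrier) → ¬ SameCoset J ε w →
          StrongPercSeq (graph I J) (PartB I J) (inj₂ ε) (inj₂ w)))
lemma3p9 CS I J _ _ _ = mk⇔
  (λ (percA , percB) →
      (λ w ε≁w → percA _ _ (inA _) (inA w) λ { (AA p) → ε≁w p })
    , (λ w ε≁w → percB _ _ (inB _) (inB w) λ { (BB p) → ε≁w p }))
  (λ (fromεA , fromεB) →
      strongPercSeq-by-transitivity ≈V-isEquivalence PartA-respects (inj₁ ε) PartA-transitive
        (λ { _ (inA w) ε≉w → fromεA w (ε≉w ∘ AA) })
    , strongPercSeq-by-transitivity ≈V-isEquivalence PartB-respects (inj₂ ε) PartB-transitive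
        (λ { _ (inB w) ε≉w → fromεB w (ε≉w ∘ BB) }))
  where
  open Group (FiniteCoxeterSystem.W CS) using (ε)
  open CoxeterGraph CS
  open Translations CS I J
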